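{- Let $F=(V,E)$ be a non-circular flow graph of value $f$ with $n$ vertices. Then $F$ contains $|E|\le O(n\sqrt{f})$ edges.
   Context: Fix terminals $s,t\in V$. A unit of $s$-$t$ flow is a directed path from $s$ to $t$. A directed graph $F$ with positive integer edge weights (multiplicities) is a flow graph of value $f$ if its edges (counted with weight) can be exactly partitioned into $f$ directed $s$-$t$ paths. It is non-circular if it contains no directed cycle. $|E|$ is the number of distinct edges. -}

module Defs where

open import Data.Nat using (ℕ; zero; suc; _+_; _*_; _≤_; _<_)
open import Data.Fin using (Fin; _≟_)
open import Data.List using (List; []; _∷_; length; map; allFin; concatMap)
open import Data.Nat.ListAction using (sum)
open import Data.Product using (_×_; _,_; ∃-syntax)
open import Data.Unit using (⊤)
open import Data.Empty using (⊥)
open import Relation.Nullary using (¬_; yes; no)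
open import Relation.Binary.PropositionalEquality using (_≡_)

-- A weighted directed graph on vertex set Fin n: w u v is the multiplicity
-- of edge (u,v); w u v ≡ 0 means the edge is absent (weights of present
-- edges are positive integers).
Graph : ℕ → Set
Graph n = Fin n → Fin n → ℕ

data Path {n : ℕ} : Fin n → Fin n → Set where
  []  : ∀ {v} → Path v v
  _∷_ : ∀ {w} (u : Fin n) {v} → Path v w → Path u w

edgeCount : ∀ {n} {a b : Fin n} → Path a b → Fin n → Fin n → ℕ
edgeCount [] x y = 0
edgeCount (_∷_ u {v} p) x y with u ≟ x | v ≟ y
... | yes _ | yes _ = suc (edgeCount p x y)
... | _     | _     = edgeCount p x y

InGraph : ∀ {n} → Graph n → {a b : Fin n} → Path a b → Set
InGraph w [] = ⊤
InGraph w (_∷_ u {v} p) = (0 < w u v) × InGraph w p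

NonEmpty : ∀ {n} {a b : Fin n} → Path a b → Set
NonEmpty [] = ⊥
NonEmpty (_ ∷ _) = ⊤

-- F is a flow graph of value f: the edges, counted with multiplicity,
-- are exactly partitioned into f directed s-t paths.
IsFlowGraph : ∀ {n} → Graph n → (s t : Fin n) → ℕ → Set
IsFlowGraph w s t f =
  ∃[ ps ] (length {A = Path s t} ps ≡ f
          × (∀ x y → w x y ≡ sum (map (λ p → edgeCount p x y) ps)))

NonCircular : ∀ {n} → Graph n → Set
NonCircular w = ∀ v (p : Path v v) → NonEmpty p → ¬ InGraph w p

numEdges : ∀ {n} → Graph n → ℕ
numEdges {n} w = sum (concatMap (λ x → map (λ y → ind (w x y)) (allFin n)) (allFin n))
  where
  ind : ℕ → ℕ
  ind zero = 0
  ind (suc _) = 1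

-- Give the vertices of the acyclic graph distinct positions 0,…,n-1 increasing along
-- edges, and let the edge (x,y) have length position y - position x ≥ 1.  Lengths
-- telescope, so every s-t path has length < n and the m edges have total length at
-- most f·n.  Out of each vertex at most k edges have length ≤ k, since their heads
-- have distinct positions in a window of width k; so at most n·k edges have length ≤ k.
-- Counting every ordered pair of edges at the longer of the two therefore gives
-- m² ≤ 2 Σ_e #{e' : len e' ≤ len e} ≤ 2n Σ_e len e ≤ 2n²f.
module Submission where

open import Defs
open import Data.Nat using (ℕ; _*_; _≤_)
open import Data.Fin using (Fin)
open import Data.Product using (∃-syntax)

open import Data.Bool using (if_then_else_)
open import Data.Empty using (⊥-elim)
open import Data.Fin using (zero; suc; toℕ; _≟_)
open import Data.Fin.Properties using (any?; injective⇒≤; toℕ<n; toℕ-injective)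
open import Data.List using (List; []; _∷_; _++_; length; map; allFin; concatMap; cartesianProduct)
open import Data.List.Membership.Propositional using (_∈_)
open import Data.List.Membership.Propositional.Properties using (∈-allFin)
open import Data.List.Properties using (map-cong; map-++; map-∘; map-tabulate; length-tabulate)
open import Data.List.Relation.Unary.Any using (here; there)
open import Data.Nat as ℕ using (zero; suc; _+_; _∸_; _<_; z≤n; s≤s; s≤s⁻¹; z<s; _<?_; _≤?_)
open import Data.Nat.ListAction using (sum)
open import Data.Nat.ListAction.Properties using (sum-++)
open import Data.Nat.Properties hiding (_≟_)
open import Data.Product using (Σ-syntax; _×_; _,_; uncurry)
open import Data.Sum using (_⊎_; inj₁; inj₂)
open import Data.Unit using (⊤; tt)
open import Function using (_∘_; id)
open import Function.Definitions using (Injective)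
open import Relation.Binary.Definitions using (tri<; tri≈; tri>)
open import Relation.Binary.PropositionalEquality
  using (_≡_; refl; sym; trans; cong; cong₂; subst; subst₂; module ≡-Reasoning)
open import Relation.Nullary using (Dec; does; ¬_; yes; no)
open import Relation.Nullary.Decidable using (_×-dec_; dec-true; dec-false)
open import Algebra.Properties.CommutativeSemigroup +-commutativeSemigroup
  using () renaming (interchange to +-interchange)
open import Algebra.Properties.CommutativeSemigroup *-commutativeSemigroup
  using () renaming (x∙yz≈y∙xz to *-exchangeˡ)

∑ : {A : Set} → List A → (A → ℕ) → ℕ
∑ xs f = sum (map f xs)

-- ∑ binds tighter than _+_ and looser than _*_: ∑[ x ∈ xs ] f x * g x sums products.
infix 6.5 ∑
syntax ∑ xs (λ x → e) = ∑[ x ∈ xs ] e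

module _ {A : Set} where

  ∑-cong : (xs : List A) {f g : A → ℕ} → (∀ x → f x ≡ g x) → ∑ xs f ≡ ∑ xs g
  ∑-cong xs f≗g = cong sum (map-cong f≗g xs)

  ∑-zero : (xs : List A) {f : A → ℕ} → (∀ x → f x ≡ 0) → ∑ xs f ≡ 0
  ∑-zero []       f≗0 = refl
  ∑-zero (x ∷ xs) f≗0 = cong₂ _+_ (f≗0 x) (∑-zero xs f≗0)

  ∑-mono-≤ : (xs : List A) {f g : A → ℕ} → (∀ x → f x ≤ g x) → ∑ xs f ≤ ∑ xs g
  ∑-mono-≤ []       f≤g = z≤n
  ∑-mono-≤ (x ∷ xs) f≤g = +-mono-≤ (f≤g x) (∑-mono-≤ xs f≤g)

  ∑-mono-< : {xs : List A} {f g : A → ℕ} {x : A} → x ∈ xs →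
             (∀ y → f y ≤ g y) → f x < g x → ∑ xs f < ∑ xs g
  ∑-mono-< {_ ∷ xs} (here refl)  f≤g fx<gx = +-mono-<-≤ fx<gx (∑-mono-≤ xs f≤g)
  ∑-mono-< {y ∷ _}  (there x∈xs) f≤g fx<gx = +-mono-≤-< (f≤g y) (∑-mono-< x∈xs f≤g fx<gx)

  ∈⇒≤∑ : {xs : List A} {x : A} (f : A → ℕ) → x ∈ xs → f x ≤ ∑ xs f
  ∈⇒≤∑ {_ ∷ xs} f (here refl)  = m≤m+n _ (∑ xs f)
  ∈⇒≤∑ {y ∷ _}  f (there x∈xs) = ≤-trans (∈⇒≤∑ f x∈xs) (m≤n+m _ (f y))

  ∑-≤-length* : (xs : List A) {f : A → ℕ} {c : ℕ} → (∀ x → x ∈ xs → f x ≤ c) →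
                ∑ xs f ≤ length xs * c
  ∑-≤-length* []       f≤c = z≤n
  ∑-≤-length* (x ∷ xs) f≤c =
    +-mono-≤ (f≤c x (here refl)) (∑-≤-length* xs (λ y y∈xs → f≤c y (there y∈xs)))

  ∑-distrib-+ : (xs : List A) (f g : A → ℕ) → ∑[ x ∈ xs ] (f x + g x) ≡ ∑ xs f + ∑ xs g
  ∑-distrib-+ []       f g = refl
  ∑-distrib-+ (x ∷ xs) f g =
    trans (cong (f x + g x +_) (∑-distrib-+ xs f g)) (+-interchange (f x) (g x) _ _)

  *-distribˡ-∑ : (c : ℕ) (xs : List A) (f : A → ℕ) → c * ∑ xs f ≡ ∑[ x ∈ xs ] c * f x
  *-distribˡ-∑ c []       f = *-zeroʳ c
  *-distribˡ-∑ c (x ∷ xs) f =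
    trans (*-distribˡ-+ c (f x) (∑ xs f)) (cong (c * f x +_) (*-distribˡ-∑ c xs f))

  *-distribʳ-∑ : (c : ℕ) (xs : List A) (f : A → ℕ) → ∑ xs f * c ≡ ∑[ x ∈ xs ] f x * c
  *-distribʳ-∑ c []       f = refl
  *-distribʳ-∑ c (x ∷ xs) f =
    trans (*-distribʳ-+ c (f x) (∑ xs f)) (cong (f x * c +_) (*-distribʳ-∑ c xs f))

module _ {A B : Set} where

  ∑-comm : (xs : List A) (ys : List B) (f : A → B → ℕ) →
           ∑[ x ∈ xs ] ∑[ y ∈ ys ] f x y ≡ ∑[ y ∈ ys ] ∑[ x ∈ xs ] f x y
  ∑-comm []       ys f = sym (∑-zero ys (λ _ → refl))
  ∑-comm (x ∷ xs) ys f =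
    trans (cong (∑ ys (f x) +_) (∑-comm xs ys f)) (sym (∑-distrib-+ ys (f x) _))

  ∑∑-distrib-+ : (xs : List A) (ys : List B) (f g : A → B → ℕ) →
                 ∑[ x ∈ xs ] ∑[ y ∈ ys ] (f x y + g x y)
                   ≡ ∑[ x ∈ xs ] ∑[ y ∈ ys ] f x y + ∑[ x ∈ xs ] ∑[ y ∈ ys ] g x y
  ∑∑-distrib-+ xs ys f g =
    trans (∑-cong xs (λ x → ∑-distrib-+ ys (f x) (g x))) (∑-distrib-+ xs _ _)

  ∑-cartesianProduct : (xs : List A) (ys : List B) (f : A × B → ℕ) →
                       ∑ (cartesianProduct xs ys) f ≡ ∑[ x ∈ xs ] ∑[ y ∈ ys ] f (x , y)
  ∑-cartesianProduct []       ys f = refl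
  ∑-cartesianProduct (x ∷ xs) ys f = begin
    sum (map f (map (x ,_) ys ++ cartesianProduct xs ys))
      ≡⟨ cong sum (map-++ f (map (x ,_) ys) _) ⟩
    sum (map f (map (x ,_) ys) ++ map f (cartesianProduct xs ys))
      ≡⟨ sum-++ (map f (map (x ,_) ys)) _ ⟩
    sum (map f (map (x ,_) ys)) + ∑ (cartesianProduct xs ys) f
      ≡⟨ cong₂ _+_ (cong sum (sym (map-∘ ys))) (∑-cartesianProduct xs ys f) ⟩
    ∑[ y ∈ ys ] f (x , y) + ∑[ x′ ∈ xs ] ∑[ y ∈ ys ] f (x′ , y) ∎
    where open ≡-Reasoning

sum-concatMap : {A : Set} (g : A → List ℕ) (xs : List A) →
                sum (concatMap g xs) ≡ ∑[ x ∈ xs ] sum (g x)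
sum-concatMap g []       = refl
sum-concatMap g (x ∷ xs) = trans (sum-++ (g x) _) (cong (sum (g x) +_) (sum-concatMap g xs))

∑-allFin-suc : (n : ℕ) (f : Fin (suc n) → ℕ) →
               ∑ (allFin (suc n)) f ≡ f zero + ∑[ x ∈ allFin n ] f (suc x)
∑-allFin-suc n f =
  cong (λ ys → f zero + sum ys) (trans (map-tabulate suc f) (sym (map-tabulate id (f ∘ suc))))

length-allFin : ∀ n → length (allFin n) ≡ n
length-allFin n = length-tabulate id

∑ᴱ : ∀ {n} → (Fin n → Fin n → ℕ) → ℕ
∑ᴱ {n} g = ∑[ x ∈ allFin n ] ∑[ y ∈ allFin n ] g x y

infix 6.5 ∑ᴱ
syntax ∑ᴱ (λ x y → e) = ∑[ x , y ] e

private variable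
  P Q R : Set

-- Defined through does, so that χ (suc u ≟ suc x) reduces to χ (u ≟ x).
χ : Dec P → ℕ
χ p? = if does p? then 1 else 0

χ-true : (p? : Dec P) → P → χ p? ≡ 1
χ-true p? p rewrite dec-true p? p = refl

χ-false : (p? : Dec P) → ¬ P → χ p? ≡ 0
χ-false p? ¬p rewrite dec-false p? ¬p = refl

χ≤1 : (p? : Dec P) → χ p? ≤ 1
χ≤1 (yes _) = ≤-refl
χ≤1 (no _)  = z≤n

χ-mono : (p? : Dec P) (q? : Dec Q) → (P → Q) → χ p? ≤ χ q?
χ-mono (yes p) q? P⇒Q = ≤-reflexive (sym (χ-true q? (P⇒Q p)))
χ-mono (no _)  q? P⇒Q = z≤n

χ-cong : (p? : Dec P) (q? : Dec Q) → (P → Q) → (Q → P) → χ p? ≡ χ q?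
χ-cong p? q? P⇒Q Q⇒P = ≤-antisym (χ-mono p? q? P⇒Q) (χ-mono q? p? Q⇒P)

χ-< : (p? : Dec P) (q? : Dec Q) → ¬ P → Q → χ p? < χ q?
χ-< p? q? ¬p q = subst₂ _<_ (sym (χ-false p? ¬p)) (sym (χ-true q? q)) z<s

χ-≤-+ : (p? : Dec P) (q? : Dec Q) (r? : Dec R) → (P → Q ⊎ R) → χ p? ≤ χ q? + χ r?
χ-≤-+ (no _)  q? r? P⇒Q⊎R = z≤n
χ-≤-+ (yes p) q? r? P⇒Q⊎R with P⇒Q⊎R p
... | inj₁ q = ≤-trans (χ-mono (yes p) q? (λ _ → q)) (m≤m+n (χ q?) (χ r?))
... | inj₂ r = ≤-trans (χ-mono (yes p) r? (λ _ → r)) (m≤n+m (χ r?) (χ q?))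

∑-δ : ∀ {n} (u : Fin n) (h : Fin n → ℕ) → ∑[ x ∈ allFin n ] χ (u ≟ x) * h x ≡ h u
∑-δ {suc n} zero    h = begin
  ∑[ x ∈ allFin (suc n) ] χ (zero ≟ x) * h x ≡⟨ ∑-allFin-suc n _ ⟩
  h zero + 0 + ∑[ x ∈ allFin n ] 0           ≡⟨ cong (h zero + 0 +_) (∑-zero (allFin n) (λ _ → refl)) ⟩
  h zero + 0 + 0                             ≡⟨ trans (+-identityʳ _) (+-identityʳ _) ⟩
  h zero                                     ∎
  where open ≡-Reasoning
∑-δ {suc n} (suc u) h = trans (∑-allFin-suc n (λ x → χ (suc u ≟ x) * h x)) (∑-δ u (h ∘ suc))

∑-δ² : ∀ {n} (u v : Fin n) (g : Fin n → Fin n → ℕ) →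
       ∑[ x , y ] χ (u ≟ x) * χ (v ≟ y) * g x y ≡ g u v
∑-δ² {n} u v g = begin
  ∑[ x , y ] χ (u ≟ x) * χ (v ≟ y) * g x y
    ≡⟨ ∑-cong (allFin n) (λ x → ∑-cong (allFin n) (λ y → *-assoc (χ (u ≟ x)) _ _)) ⟩
  ∑[ x , y ] χ (u ≟ x) * (χ (v ≟ y) * g x y)
    ≡⟨ ∑-cong (allFin n) (λ x → sym (*-distribˡ-∑ (χ (u ≟ x)) (allFin n) _)) ⟩
  ∑[ x ∈ allFin n ] χ (u ≟ x) * (∑[ y ∈ allFin n ] χ (v ≟ y) * g x y)
    ≡⟨ ∑-δ u _ ⟩
  ∑[ y ∈ allFin n ] χ (v ≟ y) * g u y
    ≡⟨ ∑-δ v (g u) ⟩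
  g u v ∎
  where open ≡-Reasoning

∑-count-≡-≤1 : ∀ {n} {g : Fin n → ℕ} → Injective _≡_ _≡_ g → ∀ c →
               ∑[ y ∈ allFin n ] χ (g y ℕ.≟ c) ≤ 1
∑-count-≡-≤1 {n} {g} g-injective c with any? (λ y → g y ℕ.≟ c)
... | no ∄y =
  ≤-trans (≤-reflexive (∑-zero (allFin n) (λ y → χ-false (g y ℕ.≟ c) (λ e → ∄y (y , e))))) z≤n
... | yes (y₀ , gy₀≡c) = ≤-reflexive (trans (∑-cong (allFin n) only-y₀) (∑-δ y₀ (λ _ → 1)))
  where
  only-y₀ : ∀ y → χ (g y ℕ.≟ c) ≡ χ (y₀ ≟ y) * 1
  only-y₀ y = trans (χ-cong (g y ℕ.≟ c) (y₀ ≟ y) (λ gy≡c → g-injective (trans gy₀≡c (sym gy≡c)))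
                                               (λ { refl → gy₀≡c }))
                    (sym (*-identityʳ _))

inWindow? : (a k b : ℕ) → Dec (a < b × b ≤ a + k)
inWindow? a k b = (a <? b) ×-dec (b ≤? a + k)

∑-window : ∀ {n} {g : Fin n → ℕ} → Injective _≡_ _≡_ g → ∀ a k →
           ∑[ y ∈ allFin n ] χ (inWindow? a k (g y)) ≤ k
∑-window {n} {g} g-injective a zero =
  ≤-reflexive (∑-zero (allFin n) (λ y → χ-false (inWindow? a 0 (g y)) empty))
  where
  empty : ∀ {b} → ¬ (a < b × b ≤ a + 0)
  empty (a<b , b≤a) = <⇒≱ a<b (subst (_ ≤_) (+-identityʳ a) b≤a)
∑-window {n} {g} g-injective a (suc k) = begin
  ∑[ y ∈ allFin n ] χ (inWindow? a (suc k) (g y))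
    ≤⟨ ∑-mono-≤ (allFin n) step ⟩
  ∑[ y ∈ allFin n ] (χ (inWindow? a k (g y)) + χ (g y ℕ.≟ a + suc k))
    ≡⟨ ∑-distrib-+ (allFin n) _ _ ⟩
  ∑[ y ∈ allFin n ] χ (inWindow? a k (g y)) + ∑[ y ∈ allFin n ] χ (g y ℕ.≟ a + suc k)
    ≤⟨ +-mono-≤ (∑-window g-injective a k) (∑-count-≡-≤1 g-injective _) ⟩
  k + 1
    ≡⟨ +-comm k 1 ⟩
  suc k ∎
  where
  open ≤-Reasoning
  shrink : ∀ {b} → a < b × b ≤ a + suc k → (a < b × b ≤ a + k) ⊎ b ≡ a + suc k
  shrink {b} (a<b , b≤) with m≤n⇒m<n∨m≡n b≤
  ... | inj₁ b< = inj₁ (a<b , s≤s⁻¹ (subst (b <_) (+-suc a k) b<))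
  ... | inj₂ b≡ = inj₂ b≡
  step : ∀ y → χ (inWindow? a (suc k) (g y)) ≤ χ (inWindow? a k (g y)) + χ (g y ℕ.≟ a + suc k)
  step y = χ-≤-+ (inWindow? a (suc k) (g y)) (inWindow? a k (g y)) (g y ℕ.≟ a + suc k) shrink

-- Total mass against mass below a key

module _ {A : Set} (xs : List A) (m κ : A → ℕ) where

  massBelow : ℕ → ℕ
  massBelow k = ∑[ y ∈ xs ] m y * χ (κ y ≤? k)

  ∑-square≤ : ∑ xs m * ∑ xs m ≤ 2 * (∑[ x ∈ xs ] m x * massBelow (κ x))
  ∑-square≤ = begin
    ∑ xs m * ∑ xs m                         ≡⟨ *-distribʳ-∑ (∑ xs m) xs m ⟩
    ∑[ x ∈ xs ] m x * ∑ xs m                ≡⟨ ∑-cong xs (λ x → *-distribˡ-∑ (m x) xs m) ⟩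
    ∑[ x ∈ xs ] ∑[ y ∈ xs ] m x * m y       ≤⟨ ∑-mono-≤ xs (λ x → ∑-mono-≤ xs (split x)) ⟩
    ∑[ x ∈ xs ] ∑[ y ∈ xs ] (T x y + T y x) ≡⟨ ∑∑-distrib-+ xs xs T (λ x y → T y x) ⟩
    ∑∑T + ∑[ x ∈ xs ] ∑[ y ∈ xs ] T y x     ≡⟨ cong (∑∑T +_) (∑-comm xs xs (λ x y → T y x)) ⟩
    ∑∑T + ∑∑T                               ≡⟨ cong₂ _+_ ∑∑T≡D ∑∑T≡D ⟩
    D + D                                   ≡⟨ cong (D +_) (sym (+-identityʳ D)) ⟩
    2 * D                                   ∎
    where
    open ≤-Reasoning
    T : A → A → ℕ
    T x y = m x * (m y * χ (κ y ≤? κ x))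
    ∑∑T D : ℕ
    ∑∑T = ∑[ x ∈ xs ] ∑[ y ∈ xs ] T x y
    D = ∑[ x ∈ xs ] m x * massBelow (κ x)
    ∑∑T≡D : ∑∑T ≡ D
    ∑∑T≡D = ∑-cong xs (λ x → sym (*-distribˡ-∑ (m x) xs _))
    unmasked : ∀ x y → κ y ≤ κ x → m y * χ (κ y ≤? κ x) ≡ m y
    unmasked x y κy≤κx = trans (cong (m y *_) (χ-true (κ y ≤? κ x) κy≤κx)) (*-identityʳ (m y))
    split : ∀ x y → m x * m y ≤ T x y + T y x
    split x y with ≤-total (κ y) (κ x)
    ... | inj₁ κy≤κx = begin
      m x * m y  ≡⟨ cong (m x *_) (unmasked x y κy≤κx) ⟨
      T x y      ≤⟨ m≤m+n (T x y) (T y x) ⟩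
      T x y + T y x ∎
    ... | inj₂ κx≤κy = begin
      m x * m y  ≡⟨ *-comm (m x) (m y) ⟩
      m y * m x  ≡⟨ cong (m y *_) (unmasked y x κx≤κy) ⟨
      T y x      ≤⟨ m≤n+m (T y x) (T x y) ⟩
      T x y + T y x ∎

  ∑-square≤-density : (c : ℕ) → (∀ k → massBelow k ≤ c * k) →
                      ∑ xs m * ∑ xs m ≤ 2 * (c * (∑[ x ∈ xs ] m x * κ x))
  ∑-square≤-density c density = ≤-trans ∑-square≤ (*-monoʳ-≤ 2 (begin
    ∑[ x ∈ xs ] m x * massBelow (κ x) ≤⟨ ∑-mono-≤ xs (λ x → *-monoʳ-≤ (m x) (density (κ x))) ⟩
    ∑[ x ∈ xs ] m x * (c * κ x)       ≡⟨ ∑-cong xs (λ x → *-exchangeˡ (m x) c (κ x)) ⟩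
    ∑[ x ∈ xs ] c * (m x * κ x)       ≡⟨ sym (*-distribˡ-∑ c xs _) ⟩
    c * (∑[ x ∈ xs ] m x * κ x)       ∎))
    where open ≤-Reasoning

-- Walks in acyclic graphs

pathLength : ∀ {n} {a b : Fin n} → Path a b → ℕ
pathLength []      = 0
pathLength (_ ∷ p) = suc (pathLength p)

vertexAt : ∀ {n} {a b : Fin n} (p : Path a b) → Fin (suc (pathLength p)) → Fin n
vertexAt {a = a} _       zero    = a
vertexAt         (_ ∷ p) (suc i) = vertexAt p i

prefix : ∀ {n} {a b : Fin n} (p : Path a b) (i : Fin (suc (pathLength p))) → Path a (vertexAt p i)
prefix _       zero    = []
prefix (u ∷ p) (suc i) = u ∷ prefix p i

module _ {n : ℕ} (w : Graph n) where

  prefix-InGraph : {a b : Fin n} (p : Path a b) (i : Fin (suc (pathLength p))) →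
                   InGraph w p → InGraph w (prefix p i)
  prefix-InGraph _       zero    _       = tt
  prefix-InGraph (u ∷ p) (suc i) (e , g) = e , prefix-InGraph p i g

  HasWalk : ℕ → Fin n → Set
  HasWalk zero    u = ⊤
  HasWalk (suc k) u = ∃[ v ] (0 < w u v × HasWalk k v)

  hasWalk? : ∀ k u → Dec (HasWalk k u)
  hasWalk? zero    u = yes tt
  hasWalk? (suc k) u = any? (λ v → (0 <? w u v) ×-dec hasWalk? k v)

  HasWalk⇒Path : ∀ k {u} → HasWalk k u →
                 ∃[ b ] Σ[ p ∈ Path u b ] (pathLength p ≡ k × InGraph w p)
  HasWalk⇒Path zero    {u} _           = u , [] , refl , tt
  HasWalk⇒Path (suc k) {u} (v , e , h) with HasWalk⇒Path k h
  ... | b , p , refl , g = b , u ∷ p , refl , e , g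

  walkCount : ℕ → Fin n → ℕ
  walkCount zero    u = 0
  walkCount (suc k) u = χ (hasWalk? k u) + walkCount k u

  walkCount-edge : ∀ {u v} → 0 < w u v → ∀ k → walkCount k v < walkCount (suc k) u
  walkCount-edge         e zero    = z<s
  walkCount-edge {u} {v} e (suc k) =
    +-mono-≤-< (χ-mono (hasWalk? k v) (hasWalk? (suc k) u) (λ h → v , e , h)) (walkCount-edge e k)

  height : Fin n → ℕ
  height = walkCount n

  module _ (acyclic : NonCircular w) where

    noClosedWalk : {a b : Fin n} (p : Path a b) → a ≡ b → NonEmpty p → ¬ InGraph w p
    noClosedWalk p refl = acyclic _ p

    vertexAt-injective : {a b : Fin n} (p : Path a b) → InGraph w p → Injective _≡_ _≡_ (vertexAt p)
    vertexAt-injective _       _       {zero}  {zero}  _  = refl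
    vertexAt-injective (u ∷ p) (e , g) {zero}  {suc j} eq =
      ⊥-elim (noClosedWalk (u ∷ prefix p j) eq tt (e , prefix-InGraph p j g))
    vertexAt-injective (u ∷ p) (e , g) {suc i} {zero}  eq =
      ⊥-elim (noClosedWalk (u ∷ prefix p i) (sym eq) tt (e , prefix-InGraph p i g))
    vertexAt-injective (u ∷ p) (_ , g) {suc i} {suc j} eq = cong suc (vertexAt-injective p g eq)

    pathLength<n : {a b : Fin n} (p : Path a b) → InGraph w p → pathLength p < n
    pathLength<n p g = injective⇒≤ (vertexAt-injective p g)

    ¬HasWalk-n : ∀ u → ¬ HasWalk n u
    ¬HasWalk-n u h with HasWalk⇒Path n h
    ... | _ , p , length≡n , g = <-irrefl length≡n (pathLength<n p g)

    height-decreasing : ∀ {u v} → 0 < w u v → height v < height u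
    height-decreasing {u} {v} e = subst (height v <_) no-walk-of-length-n (walkCount-edge e n)
      where
      no-walk-of-length-n : walkCount (suc n) u ≡ height u
      no-walk-of-length-n = cong (_+ height u) (χ-false (hasWalk? n u) (¬HasWalk-n u))

-- Topological orders

lex-< : ∀ {n a b i} j → a < b → i < n → a * n + i < b * n + j
lex-< {n} {a} {b} {i} j a<b i<n = begin-strict
  a * n + i  <⟨ +-monoʳ-< (a * n) i<n ⟩
  a * n + n  ≡⟨ +-comm (a * n) n ⟩
  suc a * n  ≤⟨ *-monoˡ-≤ n a<b ⟩
  b * n      ≤⟨ m≤m+n (b * n) j ⟩
  b * n + j  ∎
  where open ≤-Reasoning

module _ {n : ℕ} (h : Fin n → ℕ) where

  tiebreak : Fin n → ℕ
  tiebreak x = h x * n + toℕ x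

  tiebreak-mono : ∀ {x y} → h x < h y → tiebreak x < tiebreak y
  tiebreak-mono {x} {y} hx<hy = lex-< (toℕ y) hx<hy (toℕ<n x)

  tiebreak-injective : Injective _≡_ _≡_ tiebreak
  tiebreak-injective {x} {y} eq with <-cmp (h x) (h y)
  ... | tri< hx<hy _ _ = ⊥-elim (<-irrefl eq (tiebreak-mono hx<hy))
  ... | tri> _ _ hy<hx = ⊥-elim (<-irrefl (sym eq) (tiebreak-mono hy<hx))
  ... | tri≈ _ hx≡hy _ =
    toℕ-injective (+-cancelˡ-≡ (h x * n) _ _ (trans eq (cong (λ k → k * n + toℕ y) (sym hx≡hy))))

module _ {n : ℕ} (key : Fin n → ℕ) where

  rank : Fin n → ℕ
  rank x = ∑[ z ∈ allFin n ] χ (key x <? key z)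

  rank-antitone : ∀ {x y} → key x < key y → rank y < rank x
  rank-antitone {x} {y} kx<ky =
    ∑-mono-< (∈-allFin y) (λ z → χ-mono (key y <? key z) (key x <? key z) (<-trans kx<ky))
             (χ-< (key y <? key y) (key x <? key y) (n≮n (key y)) kx<ky)

  rank<n : ∀ x → rank x < n
  rank<n x = begin-strict
    rank x                 <⟨ ∑-mono-< (∈-allFin x) (λ z → χ≤1 (key x <? key z)) never-above-self ⟩
    ∑[ z ∈ allFin n ] 1    ≤⟨ ∑-≤-length* (allFin n) (λ _ _ → ≤-refl) ⟩
    length (allFin n) * 1  ≡⟨ trans (*-identityʳ _) (length-allFin n) ⟩
    n                      ∎
    where
    open ≤-Reasoning
    never-above-self : χ (key x <? key x) < 1
    never-above-self = subst (_< 1) (sym (χ-false (key x <? key x) (n≮n (key x)))) z<s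

  rank-injective : Injective _≡_ _≡_ key → Injective _≡_ _≡_ rank
  rank-injective key-injective {x} {y} eq with <-cmp (key x) (key y)
  ... | tri< kx<ky _ _ = ⊥-elim (<-irrefl (sym eq) (rank-antitone kx<ky))
  ... | tri≈ _ kx≡ky _ = key-injective kx≡ky
  ... | tri> _ _ ky<kx = ⊥-elim (<-irrefl eq (rank-antitone ky<kx))

record TopologicalOrder {n : ℕ} (w : Graph n) : Set where
  field
    position            : Fin n → ℕ
    position-injective  : Injective _≡_ _≡_ position
    position<n          : ∀ x → position x < n
    position-increasing : ∀ {u v} → 0 < w u v → position u < position v

topologicalOrder : ∀ {n} (w : Graph n) → NonCircular w → TopologicalOrder w
topologicalOrder {n} w acyclic = record
  { position            = rank key
  ; position-injective  = rank-injective key (tiebreak-injective (height w))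
  ; position<n          = rank<n key
  ; position-increasing = λ e →
      rank-antitone key (tiebreak-mono (height w) (height-decreasing w acyclic e))
  }
  where
  key : Fin n → ℕ
  key = tiebreak (height w)

-- Flow decompositions

pathWeight : ∀ {n} → (Fin n → Fin n → ℕ) → {a b : Fin n} → Path a b → ℕ
pathWeight g []            = 0
pathWeight g (_∷_ u {v} p) = g u v + pathWeight g p

module _ {n : ℕ} where

  edgeCount-∷ : (u : Fin n) {v b : Fin n} (p : Path v b) (x y : Fin n) →
                edgeCount (u ∷ p) x y ≡ χ (u ≟ x) * χ (v ≟ y) + edgeCount p x y
  edgeCount-∷ u {v} p x y with u ≟ x | v ≟ y
  ... | yes _ | yes _ = refl
  ... | yes _ | no  _ = refl
  ... | no  _ | yes _ = refl
  ... | no  _ | no  _ = refl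

  ∑-edgeCount : (g : Fin n → Fin n → ℕ) {a b : Fin n} (p : Path a b) →
                ∑[ x , y ] edgeCount p x y * g x y ≡ pathWeight g p
  ∑-edgeCount g []            = ∑-zero (allFin n) (λ x → ∑-zero (allFin n) (λ y → refl))
  ∑-edgeCount g (_∷_ u {v} p) = begin
    ∑[ x , y ] edgeCount (u ∷ p) x y * g x y
      ≡⟨ ∑-cong (allFin n) (λ x → ∑-cong (allFin n) (λ y → expand x y)) ⟩
    ∑[ x , y ] (χ (u ≟ x) * χ (v ≟ y) * g x y + edgeCount p x y * g x y)
      ≡⟨ ∑∑-distrib-+ (allFin n) (allFin n) _ _ ⟩
    ∑[ x , y ] χ (u ≟ x) * χ (v ≟ y) * g x y + ∑[ x , y ] edgeCount p x y * g x y
      ≡⟨ cong₂ _+_ (∑-δ² u v g) (∑-edgeCount g p) ⟩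
    g u v + pathWeight g p ∎
    where
    open ≡-Reasoning
    expand : ∀ x y → edgeCount (u ∷ p) x y * g x y
                     ≡ χ (u ≟ x) * χ (v ≟ y) * g x y + edgeCount p x y * g x y
    expand x y = trans (cong (_* g x y) (edgeCount-∷ u p x y))
                       (*-distribʳ-+ (g x y) (χ (u ≟ x) * χ (v ≟ y)) _)

  edgeCount≤⇒InGraph : {w : Graph n} {a b : Fin n} (p : Path a b) →
                       (∀ x y → edgeCount p x y ≤ w x y) → InGraph w p
  edgeCount≤⇒InGraph []            _ = tt
  edgeCount≤⇒InGraph (_∷_ u {v} p) count≤w =
    <-≤-trans traversed (count≤w u v) ,
    edgeCount≤⇒InGraph p (λ x y → ≤-trans (tail≤ x y) (count≤w x y))
    where
    traversed : 0 < edgeCount (u ∷ p) u v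
    traversed rewrite edgeCount-∷ u p u v | χ-true (u ≟ u) refl | χ-true (v ≟ v) refl = z<s
    tail≤ : ∀ x y → edgeCount p x y ≤ edgeCount (u ∷ p) x y
    tail≤ x y = subst (edgeCount p x y ≤_) (sym (edgeCount-∷ u p x y)) (m≤n+m _ _)

module _ {n : ℕ} {w : Graph n} {s t : Fin n} (ps : List (Path s t))
         (decomposition : ∀ x y → w x y ≡ ∑[ p ∈ ps ] edgeCount p x y) where

  flowPath-InGraph : ∀ {p} → p ∈ ps → InGraph w p
  flowPath-InGraph {p} p∈ps = edgeCount≤⇒InGraph p (λ x y →
    subst (edgeCount p x y ≤_) (sym (decomposition x y)) (∈⇒≤∑ (λ q → edgeCount q x y) p∈ps))

  ∑-weighted-flow : (g : Fin n → Fin n → ℕ) → ∑[ x , y ] w x y * g x y ≡ ∑[ p ∈ ps ] pathWeight g p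
  ∑-weighted-flow g = begin
    ∑[ x , y ] w x y * g x y
      ≡⟨ ∑-cong (allFin n) (λ x → ∑-cong (allFin n) (λ y →
           trans (cong (_* g x y) (decomposition x y)) (*-distribʳ-∑ (g x y) ps _))) ⟩
    ∑[ x , y ] ∑[ p ∈ ps ] edgeCount p x y * g x y
      ≡⟨ ∑-cong (allFin n) (λ x → ∑-comm (allFin n) ps _) ⟩
    ∑[ x ∈ allFin n ] ∑[ p ∈ ps ] ∑[ y ∈ allFin n ] edgeCount p x y * g x y
      ≡⟨ ∑-comm (allFin n) ps _ ⟩
    ∑[ p ∈ ps ] ∑[ x , y ] edgeCount p x y * g x y
      ≡⟨ ∑-cong ps (λ p → ∑-edgeCount g p) ⟩
    ∑[ p ∈ ps ] pathWeight g p ∎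
    where open ≡-Reasoning

-- Edge lengths along a topological order

sgn : ℕ → ℕ
sgn zero    = 0
sgn (suc _) = 1

sgn≤id : ∀ k → sgn k ≤ k
sgn≤id zero    = z≤n
sgn≤id (suc _) = s≤s z≤n

-- The indicator inside numEdges is local to its definition; numEdges of a
-- one-vertex graph evaluates to it.
sgn≡numEdges₁ : ∀ k → sgn k ≡ numEdges {1} (λ _ _ → k)
sgn≡numEdges₁ zero    = refl
sgn≡numEdges₁ (suc _) = refl

numEdges≡∑sgn : ∀ {n} (w : Graph n) → numEdges w ≡ ∑[ x , y ] sgn (w x y)
numEdges≡∑sgn {n} w =
  trans (sum-concatMap _ (allFin n)) (∑-cong (allFin n) (λ x → ∑-cong (allFin n) (λ y →
    trans (sym (+-identityʳ _)) (sym (sgn≡numEdges₁ (w x y))))))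

module _ {n : ℕ} {w : Graph n} (τ : TopologicalOrder w) where
  open TopologicalOrder τ

  gap : Fin n → Fin n → ℕ
  gap x y = position y ∸ position x

  pathWeight-gap : {a b : Fin n} (p : Path a b) → InGraph w p →
                   position a + pathWeight gap p ≡ position b
  pathWeight-gap []            _       = +-identityʳ _
  pathWeight-gap (_∷_ u {v} p) (e , g) = begin
    position u + (gap u v + pathWeight gap p)
      ≡⟨ sym (+-assoc (position u) (gap u v) _) ⟩
    position u + gap u v + pathWeight gap p
      ≡⟨ cong (_+ pathWeight gap p) (m+[n∸m]≡n (<⇒≤ (position-increasing e))) ⟩
    position v + pathWeight gap p
      ≡⟨ pathWeight-gap p g ⟩
    _ ∎
    where open ≡-Reasoning

  pathWeight-gap≤n : {a b : Fin n} (p : Path a b) → InGraph w p → pathWeight gap p ≤ n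
  pathWeight-gap≤n {a} {b} p g = begin
    pathWeight gap p              ≤⟨ m≤n+m _ (position a) ⟩
    position a + pathWeight gap p ≡⟨ pathWeight-gap p g ⟩
    position b                    ≤⟨ <⇒≤ (position<n b) ⟩
    n                             ∎
    where open ≤-Reasoning

  short-edges-from : ∀ x k → ∑[ y ∈ allFin n ] sgn (w x y) * χ (gap x y ≤? k) ≤ k
  short-edges-from x k =
    ≤-trans (∑-mono-≤ (allFin n) edge-in-window) (∑-window position-injective (position x) k)
    where
    edge-in-window : ∀ y → sgn (w x y) * χ (gap x y ≤? k) ≤ χ (inWindow? (position x) k (position y))
    edge-in-window y with w x y in wxy≡
    ... | zero  = z≤n
    ... | suc _ = ≤-trans (≤-reflexive (+-identityʳ _)) (χ-mono (gap x y ≤? k) (inWindow? _ k _) within)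
      where
      px<py : position x < position y
      px<py = position-increasing (subst (0 <_) (sym wxy≡) z<s)
      within : gap x y ≤ k → position x < position y × position y ≤ position x + k
      within gap≤k =
        px<py , subst (_≤ position x + k) (m+[n∸m]≡n (<⇒≤ px<py)) (+-monoʳ-≤ (position x) gap≤k)

  vertexPairs : List (Fin n × Fin n)
  vertexPairs = cartesianProduct (allFin n) (allFin n)

  edgeMass : Fin n × Fin n → ℕ
  edgeMass = uncurry (λ x y → sgn (w x y))

  massBelow-≤ : ∀ k → massBelow vertexPairs edgeMass (uncurry gap) k ≤ n * k
  massBelow-≤ k = begin
    massBelow vertexPairs edgeMass (uncurry gap) k
      ≡⟨ ∑-cartesianProduct (allFin n) (allFin n) _ ⟩
    ∑[ x , y ] sgn (w x y) * χ (gap x y ≤? k)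
      ≤⟨ ∑-≤-length* (allFin n) (λ x _ → short-edges-from x k) ⟩
    length (allFin n) * k
      ≡⟨ cong (_* k) (length-allFin n) ⟩
    n * k ∎
    where open ≤-Reasoning

  ∑-edgeMass-gap≤ : {s t : Fin n} (ps : List (Path s t)) →
                    (∀ x y → w x y ≡ ∑[ p ∈ ps ] edgeCount p x y) →
                    ∑[ e ∈ vertexPairs ] edgeMass e * uncurry gap e ≤ length ps * n
  ∑-edgeMass-gap≤ ps decomposition = begin
    ∑[ e ∈ vertexPairs ] edgeMass e * uncurry gap e ≡⟨ ∑-cartesianProduct (allFin n) (allFin n) _ ⟩
    ∑[ x , y ] sgn (w x y) * gap x y
      ≤⟨ ∑-mono-≤ (allFin n) (λ x → ∑-mono-≤ (allFin n) (λ y →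
           *-monoˡ-≤ (gap x y) (sgn≤id (w x y)))) ⟩
    ∑[ x , y ] w x y * gap x y                      ≡⟨ ∑-weighted-flow ps decomposition gap ⟩
    ∑[ p ∈ ps ] pathWeight gap p
      ≤⟨ ∑-≤-length* ps (λ p p∈ps → pathWeight-gap≤n p (flowPath-InGraph ps decomposition p∈ps)) ⟩
    length ps * n                                   ∎
    where open ≤-Reasoning

  numEdges-squared≤ : ∀ {s t f} → IsFlowGraph w s t f → numEdges w * numEdges w ≤ 2 * (n * n * f)
  numEdges-squared≤ (ps , refl , decomposition) = begin
    numEdges w * numEdges w
      ≡⟨ cong₂ _*_ numEdges≡∑edgeMass numEdges≡∑edgeMass ⟩
    ∑ vertexPairs edgeMass * ∑ vertexPairs edgeMass
      ≤⟨ ∑-square≤-density vertexPairs edgeMass (uncurry gap) n massBelow-≤ ⟩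
    2 * (n * (∑[ e ∈ vertexPairs ] edgeMass e * uncurry gap e))
      ≤⟨ *-monoʳ-≤ 2 (*-monoʳ-≤ n (∑-edgeMass-gap≤ ps decomposition)) ⟩
    2 * (n * (length ps * n))
      ≡⟨ cong (2 *_) (trans (cong (n *_) (*-comm (length ps) n)) (sym (*-assoc n n _))) ⟩
    2 * (n * n * length ps) ∎
    where
    open ≤-Reasoning
    numEdges≡∑edgeMass : numEdges w ≡ ∑ vertexPairs edgeMass
    numEdges≡∑edgeMass =
      trans (numEdges≡∑sgn w) (sym (∑-cartesianProduct (allFin n) (allFin n) edgeMass))

mainTheorem6 : ∃[ C ] (∀ (n : ℕ) (s t : Fin n) (f : ℕ) (w : Graph n) →
                 IsFlowGraph w s t f → NonCircular w →
                 numEdges w * numEdges w ≤ C * (n * n * f))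
mainTheorem6 = 2 , λ n s t f w flow acyclic → numEdges-squared≤ (topologicalOrder w acyclic) flow
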